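{- Let $T\in\mathrm{SYT}(2^k)$ with first-column entries $i_1<i_2<\dots<i_k$, and let $M=M(T)$. Then $$[W_M]=\prod_{j=1}^{k}(-1)^{i_j-j}\,\Delta(M)\in\mathbb{C}[\mathrm{Gr}(2,2k)].$$
   Context: $\mathrm{SYT}(2^k)$: standard Young tableaux with $k$ rows and $2$ columns, entries $1,\dots,2k$. $M(T)$ is the unique noncrossing perfect matching of $1,\dots,2k$ (in cyclic order on a circle) whose arcs $\{a<b\}$ have $a$ in the first column and $b$ in the second column of $T$. $\mathbb{C}[\mathrm{Gr}(2,2k)]$ is identified with $\mathrm{SL}_2$-invariant polynomial functions of $(v_1,\dots,v_{2k})\in(\mathbb{C}^2)^{2k}$, with $\Delta_{ab}=\det(v_a,v_b)$ for $a<b$; $\Delta(M)=\prod_{\{a<b\}\in M}\Delta_{ab}$. $W_M$ is the $\mathrm{SL}_2$ web obtained by replacing each arc $\{a,b\}\in M$ by an interior white vertex joined to boundary vertices $a$ and $b$ by edges of multiplicity one. Web invariant of a standard $\mathrm{SL}_k$ web $W$ with $dk$ boundary vertices (here $k=2$, $d=k$): $[W]$ is the multilinear function with $[W](e_{i_1},\dots,e_{i_{dk}})=\mathrm{sign}(\mathbf w)\,a(W,\mathbf w)$ for balanced $\mathbf w=i_1\cdots i_{dk}$ (each symbol appearing $d$ times) and $0$ otherwise, where $e_i$ are standard basis vectors; $a(W,\mathbf w)$ is the number of consistent labelings (assignments $\ell(e)\subseteq[k]$ with $|\ell(e)|=\mathrm{mult}(e)$, disjoint for edges sharing a vertex) whose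 boundary word $\ell(e_1)\cdots\ell(e_{dk})$ is $\mathbf w$; and $\mathrm{sign}(\mathbf w)$ is the sign of the ordering of $\{1_1<\dots<1_d<2_1<\dots<k_d\}$ obtained by replacing the $m$-th occurrence of $i$ in $\mathbf w$ by $i_m$. -}

module Defs where

open import Level using (Level)
open import Data.Nat as ℕ using (ℕ; zero; suc; _∸_)
open import Data.Fin as Fin using (Fin; toℕ; zero; suc)
open import Data.Fin.Properties using (_≟_; _<?_; _≤?_; all?)
open import Data.List using (List; []; _∷_; map; concatMap; foldr; filter; length; allFin)
open import Data.Product using (_×_; _,_; ∃; uncurry)
open import Data.Bool using (if_then_else_)
open import Relation.Binary.PropositionalEquality using (_≡_; _≢_)
open import Relation.Nullary using (Dec; yes; no; ¬_; does)
open import Relation.Nullary.Decidable using (_×-dec_; ¬?)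
open import Function.Definitions using (Bijective)
open import Algebra.Bundles using (CommutativeRing)

-- Standard Young tableaux of shape 2^k (k rows, 2 columns), entries
-- 1..2k encoded 0-based as Fin (2 * k).  Column index zero = first column.

record SYT2 (k : ℕ) : Set where
  field
    entry  : Fin k → Fin 2 → Fin (2 ℕ.* k)
    bij    : Bijective _≡_ _≡_ (uncurry entry)
    rowInc : ∀ j → entry j zero Fin.< entry j (suc zero)
    colInc : ∀ (j j' : Fin k) (c : Fin 2) → j Fin.< j' → entry j c Fin.< entry j' c

record PerfectMatching (n : ℕ) : Set where
  field
    μ     : Fin n → Fin n
    invol : ∀ a → μ (μ a) ≡ a
    noFix : ∀ a → μ a ≢ a

open PerfectMatching public

Noncrossing : ∀ {n} → PerfectMatching n → Set
Noncrossing M = ∀ a b c d → a Fin.< b → b Fin.< c → c Fin.< d →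
                μ M a ≡ c → μ M b ≢ d

-- Every arc {a < b} of M has a in the first column and b in the second
-- column of T.  (Together with Noncrossing this characterises M = M(T).)
ArcsFromTableau : ∀ {k} → SYT2 k → PerfectMatching (2 ℕ.* k) → Set
ArcsFromTableau {k} T M =
  ∀ a → a Fin.< μ M a →
    (∃ λ (j : Fin k) → SYT2.entry T j zero ≡ a) ×
    (∃ λ (j : Fin k) → SYT2.entry T j (suc zero) ≡ μ M a)

-- Words in the alphabet {1,2} (encoded Fin 2) of length n.

Word : ℕ → Set
Word n = Fin n → Fin 2

allWords : ∀ n → List (Word n)
allWords zero    = (λ ()) ∷ []
allWords (suc n) =
  concatMap (λ w → map (λ s → λ { zero → s ; (suc p) → w p }) (allFin 2))
            (allWords n)

occ : ∀ {n} → Word n → Fin 2 → ℕ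
occ {n} w s = length (filter (λ p → w p ≟ s) (allFin n))

occUpTo : ∀ {n} → Word n → Fin 2 → Fin n → ℕ
occUpTo {n} w s p = length (filter (λ q → (q ≤? p) ×-dec (w q ≟ s)) (allFin n))

Balanced : ∀ {n} → ℕ → Word n → Set
Balanced d w = (occ w zero ≡ d) × (occ w (suc zero) ≡ d)

balanced? : ∀ {n} d (w : Word n) → Dec (Balanced d w)
balanced? d w = (occ w zero ℕ.≟ d) ×-dec (occ w (suc zero) ℕ.≟ d)

-- position (0-based) of the letter at position p in the ordered set
-- {1_1 < ... < 1_d < 2_1 < ... < 2_d}, where the m-th occurrence of i
-- is relabelled i_m.
rank : ∀ {n} → ℕ → Word n → Fin n → ℕ
rank d w p with w p
... | zero  = occUpTo w zero p ∸ 1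
... | suc _ = d ℕ.+ (occUpTo w (suc zero) p ∸ 1)

inversions : ∀ {n} → ℕ → Word n → ℕ
inversions {n} d w =
  length (filter (λ pq → (uncurry (λ p q → p <? q) pq) ×-dec
                         (uncurry (λ p q → rank d w q ℕ.<? rank d w p) pq))
                 (concatMap (λ p → map (λ q → (p , q)) (allFin n)) (allFin n)))

-- The SL_2 web W_M: one interior white vertex per arc {a, μ a}, joined to
-- the boundary vertices a and μ a by edges of multiplicity 1.  Its edges
-- are in bijection with the boundary vertices (edge e_a joins boundary
-- vertex a to the white vertex of the arc containing a).  A labeling
-- assigns to each edge a 1-element subset of {1,2}, i.e. an element of
-- Fin 2.  Consistency: edges sharing a vertex get disjoint labels; the
-- only vertices of degree > 1 are the white vertices, whose two edges are
-- e_a and e_{μ a}.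

Labeling : ℕ → Set
Labeling n = Fin n → Fin 2

ConsistentLabeling : ∀ {n} → PerfectMatching n → Labeling n → Set
ConsistentLabeling M ℓ = ∀ a → ¬ (ℓ a ≡ ℓ (μ M a))

consistent? : ∀ {n} (M : PerfectMatching n) (ℓ : Labeling n) →
              Dec (ConsistentLabeling M ℓ)
consistent? M ℓ = all? (λ a → ¬? (ℓ a ≟ ℓ (μ M a)))

boundaryWord : ∀ {n} → Labeling n → Word n
boundaryWord ℓ = ℓ

aW : ∀ {n} → PerfectMatching n → Word n → ℕ
aW {n} M w = length (filter (λ ℓ → consistent? M ℓ ×-dec
                                   all? (λ p → boundaryWord ℓ p ≟ w p))
                            (allWords n))

-- Ring-valued functions.  Vectors v_1..v_n ∈ R^2 are given as
-- v : Fin n → Fin 2 → Carrier.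

module _ {c ℓ : Level} (R : CommutativeRing c ℓ) where
  open CommutativeRing R using (Carrier; _+_; _*_; -_; _-_; 0#; 1#)

  fromℕ : ℕ → Carrier
  fromℕ zero    = 0#
  fromℕ (suc n) = 1# + fromℕ n

  signPow : ℕ → Carrier
  signPow zero    = 1#
  signPow (suc m) = - signPow m

  prodList : List Carrier → Carrier
  prodList = foldr _*_ 1#

  sumList : List Carrier → Carrier
  sumList = foldr _+_ 0#

  webOnBasis : ∀ (k : ℕ) → PerfectMatching (2 ℕ.* k) → Word (2 ℕ.* k) → Carrier
  webOnBasis k M w with balanced? k w
  ... | yes _ = signPow (inversions k w) * fromℕ (aW M w)
  ... | no  _ = 0#

  webInvariant : ∀ (k : ℕ) → PerfectMatching (2 ℕ.* k) →
                 (Fin (2 ℕ.* k) → Fin 2 → Carrier) → Carrier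
  webInvariant k M v =
    sumList (map (λ w → webOnBasis k M w *
                        prodList (map (λ p → v p (w p)) (allFin (2 ℕ.* k))))
                 (allWords (2 ℕ.* k)))

  det2 : (Fin 2 → Carrier) → (Fin 2 → Carrier) → Carrier
  det2 x y = x zero * y (suc zero) - x (suc zero) * y zero

  DeltaM : ∀ {n} → PerfectMatching n → (Fin n → Fin 2 → Carrier) → Carrier
  DeltaM {n} M v =
    prodList (map (λ a → det2 (v a) (v (μ M a)))
                  (filter (λ a → a <? μ M a) (allFin n)))

  -- Π_{j=1}^k (-1)^{i_j - j}, with i_j the j-th first-column entry
  -- (1-based indices; the difference is the same 0-based)
  tableauSign : ∀ {k} → SYT2 k → Carrier
  tableauSign {k} T =
    prodList (map (λ j → signPow (toℕ (SYT2.entry T j zero) ∸ toℕ j)) (allFin k))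

-- In the multilinear expansion of [W_M] the coefficient of e_w is sign(w) · a(W_M, w). The only
-- possible labeling with boundary word w is w itself, and it is consistent exactly when the two ends
-- of every arc carry different letters; such a w is balanced, and its inversions are the pairs
-- "1 before 0", whose number is Σ_{w_q = 0} q − (0 + 1 + ⋯ + (k − 1)). Since M is noncrossing, every
-- arc {a < b} has b − a odd, so pairing the positions along the arcs gives
-- Σ_{w_q = 0} q ≡ Σ_j i_j + #{arcs {a < b} : w_a = 1} (mod 2), the left ends being the first column
-- of T. Hence the coefficient is Π_j (-1)^{i_j − j} · Π_{arcs {a,b}} ϵ(w_a, w_b) with ϵ the 2 × 2
-- Levi-Civita symbol (for inconsistent w both sides vanish), and the sum over all w factors arc by
-- arc into Π_{arcs {a,b}} det(v_a, v_b) = Δ(M).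

module Submission where

open import Defs
open import Level using (Level)
open import Data.Nat using (ℕ; _*_)
open import Data.Fin using (Fin)
open import Algebra.Bundles using (CommutativeRing)

open import Algebra.Bundles using (Monoid)
open import Data.Bool using (Bool; true; false; not; _xor_; if_then_else_)
import Data.Bool.Properties as Boolₚ
open import Data.Nat as ℕ using (zero; suc; _+_; _∸_; _≤_; _<_; z≤n; s≤s)
import Data.Nat.Properties as ℕₚ
open import Data.Nat.ListAction using (sum)
open import Data.Nat.ListAction.Properties using (sum-↭; sum-++)
open import Data.Fin as Fin using (toℕ)
open import Data.Fin.Patterns using (0F; 1F)
import Data.Fin.Properties as Finₚ
open import Data.Fin.Properties using (_≟_; _<?_; _≤?_; all?)
import Data.Vec.Functional as Vec
import Data.Vec.Functional.Properties as Vecₚ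
open import Data.List using (List; []; _∷_; map; concatMap; filter; length; allFin; tabulate; _++_; foldr)
import Data.List.Properties as Listₚ
open import Data.List.Membership.Propositional using (_∈_; _∉_)
open import Data.List.Relation.Unary.Any as Any using (here; there)
open import Data.List.Membership.Propositional.Properties using (∈-filter⁺; ∈-filter⁻; ∈-map⁺; ∈-map⁻; ∈-allFin)
open import Data.List.Membership.Propositional.Properties.WithK using (unique∧set⇒bag)
open import Data.List.Relation.Unary.All as All using (All; []; _∷_)
open import Data.List.Relation.Unary.AllPairs using ([]; _∷_)
open import Data.List.Relation.Unary.Unique.Propositional using (Unique)
import Data.List.Relation.Unary.Unique.Propositional.Properties as Uniqueₚ
open import Data.List.Relation.Binary.Permutation.Propositional as ↭ using (_↭_; ↭-sym; ↭⇒↭ₛ′)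
import Data.List.Relation.Binary.Permutation.Propositional.Properties as ↭ₚ
open import Data.List.Relation.Binary.BagAndSetEquality using (∼bag⇒↭)
open import Data.Product using (_×_; _,_; ∃; proj₁; proj₂)
open import Data.Sum using (_⊎_; inj₁; inj₂)
open import Function using (_∘_; id; const; mk⇔)
open import Relation.Binary.PropositionalEquality
  using (_≡_; _≢_; _≗_; refl; sym; trans; cong; cong₂; subst; subst₂; module ≡-Reasoning)
open import Relation.Binary.Definitions using (tri<; tri≈; tri>)
open import Relation.Nullary using (Dec; does; yes; no; ¬_; contradiction)
open import Relation.Nullary.Decidable using (_×-dec_; ¬?; decidable-stable)
open import Algebra.Properties.CommutativeMonoid.Sum ℕₚ.+-0-commutativeMonoid
  using (sum-syntax; sum-cong-≗; ∑-distrib-+; sum-replicate-zero)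
open import Algebra.Properties.CommutativeSemigroup ℕₚ.+-commutativeSemigroup
  using () renaming (interchange to +-interchange; xy∙z≈xz∙y to +-rightComm)
open import Algebra.Properties.Semiring.Sum ℕₚ.+-*-semiring using (*-distribˡ-sum)

𝟙 : ∀ {p} {P : Set p} → Dec P → ℕ
𝟙 d = if does d then 1 else 0

𝟙-yes : ∀ {p} {P : Set p} (d : Dec P) → P → 𝟙 d ≡ 1
𝟙-yes (yes _) _  = refl
𝟙-yes (no ¬p) p = contradiction p ¬p

𝟙-no : ∀ {p} {P : Set p} (d : Dec P) → ¬ P → 𝟙 d ≡ 0
𝟙-no (yes p) ¬p = contradiction p ¬p
𝟙-no (no _)  _  = refl

𝟙-⇔ : ∀ {p q} {P : Set p} {Q : Set q} → (P → Q) → (Q → P) →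
      (d : Dec P) (e : Dec Q) → 𝟙 d ≡ 𝟙 e
𝟙-⇔ f g (yes p) e = sym (𝟙-yes e (f p))
𝟙-⇔ f g (no ¬p) e = sym (𝟙-no e (¬p ∘ g))

𝟙-×-dec : ∀ {p q} {P : Set p} {Q : Set q} (d : Dec P) (e : Dec Q) →
          𝟙 (d ×-dec e) ≡ 𝟙 d * 𝟙 e
𝟙-×-dec (yes _) (yes _) = refl
𝟙-×-dec (yes _) (no _)  = refl
𝟙-×-dec (no _)  _       = refl

module _ {a p} {A : Set a} {P : A → Set p} (P? : ∀ x → Dec (P x)) where

  length-filter≡sum-𝟙 : ∀ xs → length (filter P? xs) ≡ sum (map (𝟙 ∘ P?) xs)
  length-filter≡sum-𝟙 []       = refl
  length-filter≡sum-𝟙 (x ∷ xs) with P? x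
  ... | yes _ = cong suc (length-filter≡sum-𝟙 xs)
  ... | no _  = length-filter≡sum-𝟙 xs

  module _ {q} {Q : A → Set q} (Q? : ∀ x → Dec (Q x)) (P⇒Q : ∀ {x} → P x → Q x) where

    length-filter-mono : ∀ xs → length (filter P? xs) ≤ length (filter Q? xs)
    length-filter-mono []       = z≤n
    length-filter-mono (x ∷ xs) with P? x | Q? x
    ... | yes _  | yes _  = s≤s (length-filter-mono xs)
    ... | yes px | no ¬qx = contradiction (P⇒Q px) ¬qx
    ... | no _   | yes _  = ℕₚ.m≤n⇒m≤1+n (length-filter-mono xs)
    ... | no _   | no _   = length-filter-mono xs

    length-filter-strictMono : ∀ {y} xs → y ∈ xs → Q y → ¬ P y →
                               length (filter P? xs) < length (filter Q? xs)
    length-filter-strictMono (x ∷ xs) (here refl) qy ¬py with P? x | Q? x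
    ... | yes py | _      = contradiction py ¬py
    ... | no _   | yes _  = s≤s (length-filter-mono xs)
    ... | no _   | no ¬qy = contradiction qy ¬qy
    length-filter-strictMono (x ∷ xs) (there y∈xs) qy ¬py with P? x | Q? x
    ... | yes _  | yes _  = s≤s (length-filter-strictMono xs y∈xs qy ¬py)
    ... | yes px | no ¬qx = contradiction (P⇒Q px) ¬qx
    ... | no _   | yes _  = ℕₚ.m≤n⇒m≤1+n (length-filter-strictMono xs y∈xs qy ¬py)
    ... | no _   | no _   = length-filter-strictMono xs y∈xs qy ¬py

module _ {a} {A : Set a} where

  sum-map-cong : ∀ {f g : A → ℕ} xs → (∀ {x} → x ∈ xs → f x ≡ g x) →
                 sum (map f xs) ≡ sum (map g xs)
  sum-map-cong []       _   = refl
  sum-map-cong (x ∷ xs) f≡g = cong₂ _+_ (f≡g (here refl)) (sum-map-cong xs (f≡g ∘ there))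

  sum-map-+ : ∀ (f g : A → ℕ) xs → sum (map (λ x → f x + g x) xs) ≡ sum (map f xs) + sum (map g xs)
  sum-map-+ f g []       = refl
  sum-map-+ f g (x ∷ xs) =
    trans (cong (f x + g x +_) (sum-map-+ f g xs)) (+-interchange (f x) (g x) _ _)

  sum-concatMap : ∀ {b} {B : Set b} (f : B → ℕ) (g : A → List B) xs →
                  sum (map f (concatMap g xs)) ≡ sum (map (λ x → sum (map f (g x))) xs)
  sum-concatMap f g []       = refl
  sum-concatMap f g (x ∷ xs) = begin
    sum (map f (g x ++ concatMap g xs))
      ≡⟨ cong sum (Listₚ.map-++ f (g x) (concatMap g xs)) ⟩
    sum (map f (g x) ++ map f (concatMap g xs))
      ≡⟨ sum-++ (map f (g x)) _ ⟩
    sum (map f (g x)) + sum (map f (concatMap g xs))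
      ≡⟨ cong (sum (map f (g x)) +_) (sum-concatMap f g xs) ⟩
    sum (map f (g x)) + sum (map (λ x → sum (map f (g x))) xs) ∎
    where open ≡-Reasoning

sum-map-allFin : ∀ {n} (f : Fin n → ℕ) → sum (map f (allFin n)) ≡ ∑[ i < n ] f i
sum-map-allFin {n} f = trans (cong sum (Listₚ.map-tabulate id f)) (sum-tabulate f)
  where
  sum-tabulate : ∀ {m} (g : Fin m → ℕ) → sum (tabulate g) ≡ ∑[ i < m ] g i
  sum-tabulate {zero}  g = refl
  sum-tabulate {suc m} g = cong (g 0F +_) (sum-tabulate (g ∘ Fin.suc))

∑-const-1 : ∀ n → ∑[ i < n ] 1 ≡ n
∑-const-1 zero    = refl
∑-const-1 (suc n) = cong suc (∑-const-1 n)

∑-𝟙-<? : ∀ {n} m → m ≤ n → ∑[ p < n ] 𝟙 (toℕ p ℕ.<? m) ≡ m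
∑-𝟙-<? {n}     zero    _         = sum-replicate-zero n
∑-𝟙-<? {suc n} (suc m) (s≤s m≤n) = cong suc (trans (sum-cong-≗ {n} shift) (∑-𝟙-<? m m≤n))
  where
  shift : ∀ p → 𝟙 (suc (toℕ p) ℕ.<? suc m) ≡ 𝟙 (toℕ p ℕ.<? m)
  shift p = 𝟙-⇔ ℕ.s≤s⁻¹ s≤s (suc (toℕ p) ℕ.<? suc m) (toℕ p ℕ.<? m)

length-between : ∀ {n} (a b : Fin n) → a Fin.< b →
                 toℕ b ≡ suc (toℕ a + length (filter (λ p → (a <? p) ×-dec (p <? b)) (allFin n)))
length-between {n} a b a<b = begin
  toℕ b
    ≡⟨ sym (∑-𝟙-<? (toℕ b) (ℕₚ.<⇒≤ (Finₚ.toℕ<n b))) ⟩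
  ∑[ p < n ] 𝟙 (p <? b)
    ≡⟨ sym (sum-cong-≗ {n} split) ⟩
  ∑[ p < n ] (𝟙 (toℕ p ℕ.<? suc (toℕ a)) + 𝟙 (between? p))
    ≡⟨ ∑-distrib-+ {n} (λ p → 𝟙 (toℕ p ℕ.<? suc (toℕ a))) (𝟙 ∘ between?) ⟩
  ∑[ p < n ] 𝟙 (toℕ p ℕ.<? suc (toℕ a)) + ∑[ p < n ] 𝟙 (between? p)
    ≡⟨ cong₂ _+_ (∑-𝟙-<? (suc (toℕ a)) (ℕₚ.<-trans a<b (Finₚ.toℕ<n b)))
                 (sym (trans (length-filter≡sum-𝟙 between? (allFin n)) (sum-map-allFin (𝟙 ∘ between?)))) ⟩
  suc (toℕ a + length (filter between? (allFin n))) ∎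
  where
  open ≡-Reasoning
  between? : ∀ p → Dec (a Fin.< p × p Fin.< b)
  between? p = (a <? p) ×-dec (p <? b)
  split : ∀ p → 𝟙 (toℕ p ℕ.<? suc (toℕ a)) + 𝟙 (between? p) ≡ 𝟙 (p <? b)
  split p with a <? p
  ... | yes a<p = cong₂ _+_ (𝟙-no (toℕ p ℕ.<? suc (toℕ a)) (ℕₚ.<⇒≱ a<p ∘ ℕ.s≤s⁻¹))
                            (𝟙-⇔ proj₂ (a<p ,_) (between? p) (p <? b))
  ... | no  a≮p = begin
    𝟙 (toℕ p ℕ.<? suc (toℕ a)) + 𝟙 (between? p) ≡⟨ cong₂ _+_ (𝟙-yes (toℕ p ℕ.<? suc (toℕ a)) (s≤s p≤a))
                                                              (𝟙-no (between? p) (a≮p ∘ proj₁)) ⟩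
    1                                          ≡⟨ sym (𝟙-yes (p <? b) (ℕₚ.≤-<-trans p≤a a<b)) ⟩
    𝟙 (p <? b)                                 ∎
    where
    p≤a : p Fin.≤ a
    p≤a = ℕₚ.≮⇒≥ a≮p

parity : ℕ → Bool
parity zero    = false
parity (suc n) = not (parity n)

parity-+ : ∀ m n → parity (m + n) ≡ parity m xor parity n
parity-+ zero    n = refl
parity-+ (suc m) n = trans (cong not (parity-+ m n)) (Boolₚ.not-distribˡ-xor (parity m) (parity n))

parity-double : ∀ m → parity (m + m) ≡ false
parity-double m = trans (parity-+ m m) (Boolₚ.xor-same (parity m))

parity-+-cancelʳ : ∀ m n t → parity (m + t) ≡ parity (n + t) → parity m ≡ parity n
parity-+-cancelʳ m n t eq = begin
  parity m                             ≡⟨ sym (xor-cancelʳ (parity m)) ⟩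
  (parity m xor parity t) xor parity t ≡⟨ cong (_xor parity t) eq′ ⟩
  (parity n xor parity t) xor parity t ≡⟨ xor-cancelʳ (parity n) ⟩
  parity n                             ∎
  where
  open ≡-Reasoning
  xor-cancelʳ : ∀ x → (x xor parity t) xor parity t ≡ x
  xor-cancelʳ x = trans (Boolₚ.xor-assoc x (parity t) (parity t))
                        (trans (cong (x xor_) (Boolₚ.xor-same (parity t))) (Boolₚ.xor-identityʳ x))
  eq′ : parity m xor parity t ≡ parity n xor parity t
  eq′ = trans (sym (parity-+ m t)) (trans eq (parity-+ n t))

parity-sum-map-cong : ∀ {a} {A : Set a} {f g : A → ℕ} xs →
                      (∀ {x} → x ∈ xs → parity (f x) ≡ parity (g x)) →
                      parity (sum (map f xs)) ≡ parity (sum (map g xs))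
parity-sum-map-cong {f = f} {g} []       _  = refl
parity-sum-map-cong {f = f} {g} (x ∷ xs) eq = begin
  parity (f x + sum (map f xs))                ≡⟨ parity-+ (f x) _ ⟩
  parity (f x) xor parity (sum (map f xs))     ≡⟨ cong₂ _xor_ (eq (here refl)) (parity-sum-map-cong xs (eq ∘ there)) ⟩
  parity (g x) xor parity (sum (map g xs))     ≡⟨ sym (parity-+ (g x) _) ⟩
  parity (g x + sum (map g xs))                ∎
  where open ≡-Reasoning

triangular : ℕ → ℕ
triangular zero    = 0
triangular (suc m) = triangular m + m

∑-toℕ : ∀ n → ∑[ i < n ] toℕ i ≡ triangular n
∑-toℕ zero    = refl
∑-toℕ (suc n) = begin
  ∑[ i < n ] suc (toℕ i)           ≡⟨ ∑-distrib-+ {n} (λ _ → 1) toℕ ⟩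
  ∑[ i < n ] 1 + ∑[ i < n ] toℕ i  ≡⟨ cong₂ _+_ (∑-const-1 n) (∑-toℕ n) ⟩
  n + triangular n                 ≡⟨ ℕₚ.+-comm n (triangular n) ⟩
  triangular n + n                 ∎
  where open ≡-Reasoning

module _ {c ℓ} (Mo : Monoid c ℓ) where
  open Monoid Mo using (Carrier; _≈_; _∙_; ε; ∙-cong; ∙-congˡ; assoc; identityˡ; identityʳ; setoid)
    renaming (refl to ≈-refl; sym to ≈-sym; trans to ≈-trans)

  foldr-++ : ∀ xs ys → foldr _∙_ ε (xs ++ ys) ≈ foldr _∙_ ε xs ∙ foldr _∙_ ε ys
  foldr-++ []       ys = ≈-sym (identityˡ _)
  foldr-++ (x ∷ xs) ys = ≈-trans (∙-congˡ (foldr-++ xs ys)) (≈-sym (assoc x _ _))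

  foldr-allWords-suc : ∀ {n} (f : Word (suc n) → Carrier) → (∀ {ℓ ℓ′} → ℓ ≗ ℓ′ → f ℓ ≈ f ℓ′) →
    foldr _∙_ ε (map f (allWords (suc n))) ≈ foldr _∙_ ε (map (λ w → f (0F Vec.∷ w) ∙ f (1F Vec.∷ w)) (allWords n))
  foldr-allWords-suc {n} f f-cong = go _ (λ w → ∙-cong (f-cong λ { 0F → refl ; (Fin.suc p) → refl })
      (≈-trans (identityʳ _) (f-cong λ { 0F → refl ; (Fin.suc p) → refl }))) (allWords n)
    where
    go : ∀ (extend : Word n → List (Word (suc n))) →
         (∀ w → foldr _∙_ ε (map f (extend w)) ≈ f (0F Vec.∷ w) ∙ f (1F Vec.∷ w)) →
         ∀ ws → foldr _∙_ ε (map f (concatMap extend ws))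
                ≈ foldr _∙_ ε (map (λ w → f (0F Vec.∷ w) ∙ f (1F Vec.∷ w)) ws)
    go extend eq []       = ≈-refl
    go extend eq (w ∷ ws) = begin
      foldr _∙_ ε (map f (extend w ++ concatMap extend ws))
        ≡⟨ cong (foldr _∙_ ε) (Listₚ.map-++ f (extend w) (concatMap extend ws)) ⟩
      foldr _∙_ ε (map f (extend w) ++ map f (concatMap extend ws))
        ≈⟨ foldr-++ (map f (extend w)) _ ⟩
      foldr _∙_ ε (map f (extend w)) ∙ foldr _∙_ ε (map f (concatMap extend ws))
        ≈⟨ ∙-cong (eq w) (go extend eq ws) ⟩
      (f (0F Vec.∷ w) ∙ f (1F Vec.∷ w)) ∙ foldr _∙_ ε (map (λ w → f (0F Vec.∷ w) ∙ f (1F Vec.∷ w)) ws) ∎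
      where open import Relation.Binary.Reasoning.Setoid setoid

module Matching {n : ℕ} (M : PerfectMatching n) where

  μ-injective : ∀ {a b} → μ M a ≡ μ M b → a ≡ b
  μ-injective {a} {b} eq = trans (sym (invol M a)) (trans (cong (μ M) eq) (invol M b))

  μ-swap : ∀ {a b} → a ≡ μ M b → μ M a ≡ b
  μ-swap {b = b} eq = trans (cong (μ M) eq) (invol M b)

  μ-<-flip : ∀ a → ¬ (a Fin.< μ M a) → μ M a Fin.< μ M (μ M a)
  μ-<-flip a a≮μa = subst (μ M a Fin.<_) (sym (invol M a))
    (ℕₚ.≤∧≢⇒< (ℕₚ.≮⇒≥ a≮μa) (λ eq → noFix M a (Finₚ.toℕ-injective eq)))

  arcsIn : List (Fin n) → List (Fin n)
  arcsIn = filter (λ a → a <? μ M a)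

  endpoints : List (Fin n) → List (Fin n)
  endpoints []       = []
  endpoints (a ∷ as) = a ∷ μ M a ∷ endpoints as

  ∈-endpoints⁻ : ∀ {y} as → y ∈ endpoints as → ∃ λ a → a ∈ as × (y ≡ a ⊎ y ≡ μ M a)
  ∈-endpoints⁻ (a ∷ as) (here eq)         = a , here refl , inj₁ eq
  ∈-endpoints⁻ (a ∷ as) (there (here eq)) = a , here refl , inj₂ eq
  ∈-endpoints⁻ (a ∷ as) (there (there y∈)) with ∈-endpoints⁻ as y∈
  ... | b , b∈ , eq = b , there b∈ , eq

  ∈-endpointsˡ : ∀ {a} as → a ∈ as → a ∈ endpoints as
  ∈-endpointsˡ (a ∷ as) (here refl) = here refl
  ∈-endpointsˡ (b ∷ as) (there a∈)  = there (there (∈-endpointsˡ as a∈))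

  ∈-endpointsʳ : ∀ {a} as → a ∈ as → μ M a ∈ endpoints as
  ∈-endpointsʳ (a ∷ as) (here refl) = there (here refl)
  ∈-endpointsʳ (b ∷ as) (there a∈)  = there (there (∈-endpointsʳ as a∈))

  endpoints-unique : ∀ as → Unique as → All (λ a → a Fin.< μ M a) as → Unique (endpoints as)
  endpoints-unique []       _              _            = []
  endpoints-unique (a ∷ as) (a∉as ∷ as!) (a<μa ∷ as<μ) =
    All.tabulate a∉ ∷ All.tabulate μa∉ ∷ endpoints-unique as as! as<μ
    where
    a∉ : ∀ {y} → y ∈ μ M a ∷ endpoints as → a ≢ y
    a∉ (here refl) eq = noFix M a (sym eq)
    a∉ (there y∈) with ∈-endpoints⁻ as y∈
    ... | b , b∈ , inj₁ refl = All.lookup a∉as b∈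
    ... | b , b∈ , inj₂ refl = λ a≡μb →
      ℕₚ.<-asym (subst (b Fin.<_) (sym a≡μb) (All.lookup as<μ b∈))
                (subst (a Fin.<_) (μ-swap a≡μb) a<μa)
    μa∉ : ∀ {y} → y ∈ endpoints as → μ M a ≢ y
    μa∉ y∈ with ∈-endpoints⁻ as y∈
    ... | b , b∈ , inj₁ refl = λ μa≡b →
      ℕₚ.<-asym (subst (b Fin.<_) (μ-swap (sym μa≡b)) (All.lookup as<μ b∈))
                (subst (a Fin.<_) μa≡b a<μa)
    ... | b , b∈ , inj₂ refl = All.lookup a∉as b∈ ∘ μ-injective

  arcsIn-< : ∀ X → All (λ a → a Fin.< μ M a) (arcsIn X)
  arcsIn-< X = All.tabulate (proj₂ ∘ ∈-filter⁻ (λ a → a <? μ M a) {xs = X})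

  ↭-endpoints-arcsIn : ∀ X → Unique X → (∀ {x} → x ∈ X → μ M x ∈ X) → X ↭ endpoints (arcsIn X)
  ↭-endpoints-arcsIn X X! closed = ∼bag⇒↭ (unique∧set⇒bag X!
    (endpoints-unique (arcsIn X) (Uniqueₚ.filter⁺ (λ a → a <? μ M a) X!) (arcsIn-< X))
    (mk⇔ to from))
    where
    to : ∀ {x} → x ∈ X → x ∈ endpoints (arcsIn X)
    to {x} x∈ with x <? μ M x
    ... | yes x<μx = ∈-endpointsˡ (arcsIn X) (∈-filter⁺ (λ a → a <? μ M a) x∈ x<μx)
    ... | no  x≮μx = subst (_∈ endpoints (arcsIn X)) (invol M x)
      (∈-endpointsʳ (arcsIn X) (∈-filter⁺ (λ a → a <? μ M a) (closed x∈) (μ-<-flip x x≮μx)))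
    from : ∀ {x} → x ∈ endpoints (arcsIn X) → x ∈ X
    from x∈ with ∈-endpoints⁻ (arcsIn X) x∈
    ... | b , b∈ , inj₁ refl = proj₁ (∈-filter⁻ (λ a → a <? μ M a) {xs = X} b∈)
    ... | b , b∈ , inj₂ refl = closed (proj₁ (∈-filter⁻ (λ a → a <? μ M a) {xs = X} b∈))

  length-endpoints : ∀ as → length (endpoints as) ≡ length as + length as
  length-endpoints []       = refl
  length-endpoints (a ∷ as) =
    cong suc (trans (cong suc (length-endpoints as)) (sym (ℕₚ.+-suc (length as) (length as))))

  foldr-map-endpoints : ∀ {c ℓ} (Mo : Monoid c ℓ) (f : Fin n → Monoid.Carrier Mo) as →
    let open Monoid Mo in
    foldr _∙_ ε (map f (endpoints as)) ≈ foldr _∙_ ε (map (λ a → f a ∙ f (μ M a)) as)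
  foldr-map-endpoints Mo f []       = Monoid.refl Mo
  foldr-map-endpoints Mo f (a ∷ as) =
    Mo.trans (Mo.∙-congˡ (Mo.∙-congˡ (foldr-map-endpoints Mo f as))) (Mo.sym (Mo.assoc (f a) (f (μ M a)) _))
    where module Mo = Monoid Mo

  arcs : List (Fin n)
  arcs = arcsIn (allFin n)

  arcs-unique : Unique arcs
  arcs-unique = Uniqueₚ.filter⁺ (λ a → a <? μ M a) (Uniqueₚ.allFin⁺ n)

  ∈-arcs⁺ : ∀ {a} → a Fin.< μ M a → a ∈ arcs
  ∈-arcs⁺ = ∈-filter⁺ (λ a → a <? μ M a) (∈-allFin _)

  ∈-arcs⁻ : ∀ {a} → a ∈ arcs → a Fin.< μ M a
  ∈-arcs⁻ = proj₂ ∘ ∈-filter⁻ (λ a → a <? μ M a) {xs = allFin n}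

  allFin↭endpoints-arcs : allFin n ↭ endpoints arcs
  allFin↭endpoints-arcs = ↭-endpoints-arcsIn (allFin n) (Uniqueₚ.allFin⁺ n) (λ _ → ∈-allFin _)

  sum-allFin≡sum-arcs : ∀ (f : Fin n → ℕ) → sum (map f (allFin n)) ≡ sum (map (λ a → f a + f (μ M a)) arcs)
  sum-allFin≡sum-arcs f =
    trans (sum-↭ (↭ₚ.map⁺ f allFin↭endpoints-arcs)) (foldr-map-endpoints ℕₚ.+-0-monoid f arcs)

  length-arcs : length arcs + length arcs ≡ n
  length-arcs = begin
    length arcs + length arcs ≡⟨ sym (length-endpoints arcs) ⟩
    length (endpoints arcs)   ≡⟨ sym (↭ₚ.↭-length allFin↭endpoints-arcs) ⟩
    length (allFin n)         ≡⟨ Listₚ.length-tabulate id ⟩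
    n                         ∎
    where open ≡-Reasoning

module NoncrossingMatching {n : ℕ} {M : PerfectMatching n} (NC : Noncrossing M) where
  open Matching M

  inside : Fin n → List (Fin n)
  inside a = filter (λ p → (a <? p) ×-dec (p <? μ M a)) (allFin n)

  inside-closed : ∀ a {x} → x ∈ inside a → μ M x ∈ inside a
  inside-closed a {x} x∈ with ∈-filter⁻ (λ p → (a <? p) ×-dec (p <? μ M a)) {xs = allFin n} x∈
  ... | _ , a<x , x<μa = ∈-filter⁺ (λ p → (a <? p) ×-dec (p <? μ M a)) (∈-allFin _) (a<μx , μx<μa)
    where
    a<μx : a Fin.< μ M x
    a<μx with Finₚ.<-cmp a (μ M x)
    ... | tri< lt _ _ = lt
    ... | tri≈ _ eq _ = contradiction (cong toℕ (sym (μ-swap eq))) (ℕₚ.<⇒≢ x<μa)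
    ... | tri> _ _ gt = contradiction refl (NC (μ M x) a x (μ M a) gt a<x x<μa (invol M x))
    μx<μa : μ M x Fin.< μ M a
    μx<μa with Finₚ.<-cmp (μ M x) (μ M a)
    ... | tri< lt _ _ = lt
    ... | tri≈ _ eq _ = contradiction (cong toℕ (μ-injective eq)) (ℕₚ.<⇒≢ a<x ∘ sym)
    ... | tri> _ _ gt = contradiction refl (NC a x (μ M a) (μ M x) a<x x<μa gt refl)

  arc-length-odd : ∀ a → a Fin.< μ M a → ∃ λ m → toℕ (μ M a) ≡ suc (toℕ a + (m + m))
  arc-length-odd a a<μa = L , (begin
    toℕ (μ M a)
      ≡⟨ length-between a (μ M a) a<μa ⟩
    suc (toℕ a + length (inside a))
      ≡⟨ cong (λ l → suc (toℕ a + l)) (↭ₚ.↭-length inside↭) ⟩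
    suc (toℕ a + length (endpoints (arcsIn (inside a))))
      ≡⟨ cong (λ l → suc (toℕ a + l)) (length-endpoints (arcsIn (inside a))) ⟩
    suc (toℕ a + (L + L)) ∎)
    where
    open ≡-Reasoning
    L : ℕ
    L = length (arcsIn (inside a))
    inside↭ : inside a ↭ endpoints (arcsIn (inside a))
    inside↭ = ↭-endpoints-arcsIn (inside a)
      (Uniqueₚ.filter⁺ (λ p → (a <? p) ×-dec (p <? μ M a)) (Uniqueₚ.allFin⁺ n)) (inside-closed a)

toℕ≤strictMono : ∀ {k} (f : Fin k → ℕ) → (∀ {i j} → i Fin.< j → f i < f j) → ∀ j → toℕ j ≤ f j
toℕ≤strictMono f mono 0F = z≤n
toℕ≤strictMono {suc k} f mono (Fin.suc i) =
  ℕₚ.≤-<-trans (toℕ≤strictMono (f ∘ Fin.inject₁) mono′ i) (mono (Finₚ.≤̄⇒inject₁< ℕₚ.≤-refl))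
  where
  mono′ : ∀ {i j} → i Fin.< j → f (Fin.inject₁ i) < f (Fin.inject₁ j)
  mono′ {i} {j} i<j = mono (subst₂ _<_ (sym (Finₚ.toℕ-inject₁ i)) (sym (Finₚ.toℕ-inject₁ j)) i<j)

module Tableau {k : ℕ} (T : SYT2 k) where

  firstEntry : Fin k → Fin (2 * k)
  firstEntry j = SYT2.entry T j 0F

  firstColumnExcess : ℕ
  firstColumnExcess = sum (map (λ j → toℕ (firstEntry j) ∸ toℕ j) (allFin k))

  sum-firstColumn : sum (map (toℕ ∘ firstEntry) (allFin k)) ≡ firstColumnExcess + triangular k
  sum-firstColumn = begin
    sum (map (toℕ ∘ firstEntry) (allFin k))
      ≡⟨ sum-map-allFin (toℕ ∘ firstEntry) ⟩
    ∑[ j < k ] toℕ (firstEntry j)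
      ≡⟨ sym (sum-cong-≗ {k} (λ j → ℕₚ.m∸n+n≡m (toℕ≤firstEntry j))) ⟩
    ∑[ j < k ] (toℕ (firstEntry j) ∸ toℕ j + toℕ j)
      ≡⟨ ∑-distrib-+ {k} (λ j → toℕ (firstEntry j) ∸ toℕ j) toℕ ⟩
    ∑[ j < k ] (toℕ (firstEntry j) ∸ toℕ j) + ∑[ j < k ] toℕ j
      ≡⟨ cong₂ _+_ (sym (sum-map-allFin (λ j → toℕ (firstEntry j) ∸ toℕ j))) (∑-toℕ k) ⟩
    firstColumnExcess + triangular k ∎
    where
    open ≡-Reasoning
    -- i_j ≥ j, so the truncated subtraction in the exponent of tableauSign loses nothing.
    toℕ≤firstEntry : ∀ j → toℕ j ≤ toℕ (firstEntry j)
    toℕ≤firstEntry = toℕ≤strictMono (toℕ ∘ firstEntry) (λ {i} {j} → SYT2.colInc T i j 0F)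

  module _ (M : PerfectMatching (2 * k)) (AT : ArcsFromTableau T M) where
    open Matching M

    firstColumn↭arcs : map firstEntry (allFin k) ↭ arcs
    firstColumn↭arcs = ∼bag⇒↭ (unique∧set⇒bag
      (Uniqueₚ.map⁺ firstEntry-injective (Uniqueₚ.allFin⁺ k)) arcs-unique (mk⇔ to from))
      where
      firstEntry-injective : ∀ {i j} → firstEntry i ≡ firstEntry j → i ≡ j
      firstEntry-injective eq = cong proj₁ (proj₁ (SYT2.bij T) eq)
      to : ∀ {x} → x ∈ map firstEntry (allFin k) → x ∈ arcs
      to x∈ with ∈-map⁻ firstEntry x∈
      ... | j , _ , refl with firstEntry j <? μ M (firstEntry j)
      ...   | yes lt = ∈-arcs⁺ lt
      ...   | no  ≮  with AT (μ M (firstEntry j)) (μ-<-flip (firstEntry j) ≮)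
      ...     | _ , (j′ , e) = contradiction
                  (cong proj₂ (proj₁ (SYT2.bij T) (trans e (invol M (firstEntry j)))))
                  (λ ())
      from : ∀ {x} → x ∈ arcs → x ∈ map firstEntry (allFin k)
      from x∈ with AT _ (∈-arcs⁻ x∈)
      ... | (j , refl) , _ = ∈-map⁺ firstEntry (∈-allFin j)

    sum-arcs : sum (map toℕ arcs) ≡ firstColumnExcess + triangular k
    sum-arcs = begin
      sum (map toℕ arcs)                      ≡⟨ sum-↭ (↭ₚ.map⁺ toℕ (↭-sym firstColumn↭arcs)) ⟩
      sum (map toℕ (map firstEntry (allFin k))) ≡⟨ cong sum (sym (Listₚ.map-∘ (allFin k))) ⟩
      sum (map (toℕ ∘ firstEntry) (allFin k)) ≡⟨ sum-firstColumn ⟩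
      firstColumnExcess + triangular k        ∎
      where open ≡-Reasoning

module _ {n : ℕ} where

  zeroCount : Word n → ℕ
  zeroCount w = ∑[ q < n ] 𝟙 (w q ≟ 0F)

  zeroPositionSum : Word n → ℕ
  zeroPositionSum w = ∑[ q < n ] (𝟙 (w q ≟ 0F) * toℕ q)

  onesBeforeZeros : Word n → ℕ
  onesBeforeZeros w = ∑[ p < n ] (𝟙 (w p ≟ 1F) * ∑[ q < n ] (𝟙 (p <? q) * 𝟙 (w q ≟ 0F)))

  occ≡∑ : ∀ (w : Word n) s → occ w s ≡ ∑[ q < n ] 𝟙 (w q ≟ s)
  occ≡∑ w s = trans (length-filter≡sum-𝟙 (λ q → w q ≟ s) (allFin n)) (sum-map-allFin (λ q → 𝟙 (w q ≟ s)))

zeroPositionSum-∷ : ∀ {n} s (w : Word n) → zeroPositionSum (s Vec.∷ w) ≡ zeroPositionSum w + zeroCount w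
zeroPositionSum-∷ {n} s w = begin
  𝟙 (s ≟ 0F) * 0 + ∑[ q < n ] (𝟙 (w q ≟ 0F) * suc (toℕ q))
    ≡⟨ cong₂ _+_ (ℕₚ.*-zeroʳ (𝟙 (s ≟ 0F))) (sum-cong-≗ {n} (λ q → ℕₚ.*-suc (𝟙 (w q ≟ 0F)) (toℕ q))) ⟩
  ∑[ q < n ] (𝟙 (w q ≟ 0F) + 𝟙 (w q ≟ 0F) * toℕ q)
    ≡⟨ ∑-distrib-+ {n} (λ q → 𝟙 (w q ≟ 0F)) (λ q → 𝟙 (w q ≟ 0F) * toℕ q) ⟩
  zeroCount w + zeroPositionSum w
    ≡⟨ ℕₚ.+-comm (zeroCount w) (zeroPositionSum w) ⟩
  zeroPositionSum w + zeroCount w ∎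
  where open ≡-Reasoning

onesBeforeZeros-∷ : ∀ {n} s (w : Word n) →
                    onesBeforeZeros (s Vec.∷ w) ≡ 𝟙 (s ≟ 1F) * zeroCount w + onesBeforeZeros w
onesBeforeZeros-∷ {n} s w =
  cong₂ _+_ (cong (𝟙 (s ≟ 1F) *_) (sum-cong-≗ {n} firstRow))
            (sum-cong-≗ {n} (λ p → cong (𝟙 (w p ≟ 1F) *_) (laterRow p)))
  where
  firstRow : ∀ q → 𝟙 (Fin.zero {n} <? Fin.suc q) * 𝟙 (w q ≟ 0F) ≡ 𝟙 (w q ≟ 0F)
  firstRow q = trans (cong (_* 𝟙 (w q ≟ 0F)) (𝟙-yes (Fin.zero {n} <? Fin.suc q) (s≤s z≤n)))
                     (ℕₚ.*-identityˡ (𝟙 (w q ≟ 0F)))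
  laterRow : ∀ p → 𝟙 (Fin.suc p <? Fin.zero {n}) * 𝟙 (s ≟ 0F) + ∑[ q < n ] (𝟙 (Fin.suc p <? Fin.suc q) * 𝟙 (w q ≟ 0F))
                 ≡ ∑[ q < n ] (𝟙 (p <? q) * 𝟙 (w q ≟ 0F))
  laterRow p = cong₂ _+_ (cong (_* 𝟙 (s ≟ 0F)) (𝟙-no (Fin.suc p <? Fin.zero {n}) λ ()))
    (sum-cong-≗ {n} (λ q → cong (_* 𝟙 (w q ≟ 0F)) (𝟙-⇔ ℕ.s≤s⁻¹ s≤s (Fin.suc p <? Fin.suc q) (p <? q))))

-- A 0 at position q is preceded by q letters: the 1s among them are counted by onesBeforeZeros,
-- the 0s contribute 0 + 1 + ⋯ + (zeroCount w ∸ 1).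
onesBeforeZeros+triangular : ∀ {n} (w : Word n) →
                             onesBeforeZeros w + triangular (zeroCount w) ≡ zeroPositionSum w
onesBeforeZeros+triangular {zero}  w = refl
onesBeforeZeros+triangular {suc n} w = step (w 0F) (Vec.tail w)
  where
  open ≡-Reasoning
  step : ∀ s (w′ : Word n) → onesBeforeZeros (s Vec.∷ w′) + triangular (zeroCount (s Vec.∷ w′))
                             ≡ zeroPositionSum (s Vec.∷ w′)
  step 0F w′ = begin
    onesBeforeZeros (0F Vec.∷ w′) + (triangular (zeroCount w′) + zeroCount w′)
      ≡⟨ cong (_+ (triangular (zeroCount w′) + zeroCount w′)) (onesBeforeZeros-∷ 0F w′) ⟩
    onesBeforeZeros w′ + (triangular (zeroCount w′) + zeroCount w′)
      ≡⟨ sym (ℕₚ.+-assoc (onesBeforeZeros w′) (triangular (zeroCount w′)) (zeroCount w′)) ⟩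
    onesBeforeZeros w′ + triangular (zeroCount w′) + zeroCount w′
      ≡⟨ cong (_+ zeroCount w′) (onesBeforeZeros+triangular w′) ⟩
    zeroPositionSum w′ + zeroCount w′
      ≡⟨ sym (zeroPositionSum-∷ 0F w′) ⟩
    zeroPositionSum (0F Vec.∷ w′) ∎
  step 1F w′ = begin
    onesBeforeZeros (1F Vec.∷ w′) + triangular (zeroCount w′)
      ≡⟨ cong (_+ triangular (zeroCount w′)) (onesBeforeZeros-∷ 1F w′) ⟩
    1 * zeroCount w′ + onesBeforeZeros w′ + triangular (zeroCount w′)
      ≡⟨ cong (λ z → z + onesBeforeZeros w′ + triangular (zeroCount w′)) (ℕₚ.*-identityˡ (zeroCount w′)) ⟩
    zeroCount w′ + onesBeforeZeros w′ + triangular (zeroCount w′)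
      ≡⟨ ℕₚ.+-assoc (zeroCount w′) (onesBeforeZeros w′) (triangular (zeroCount w′)) ⟩
    zeroCount w′ + (onesBeforeZeros w′ + triangular (zeroCount w′))
      ≡⟨ cong (zeroCount w′ +_) (onesBeforeZeros+triangular w′) ⟩
    zeroCount w′ + zeroPositionSum w′
      ≡⟨ ℕₚ.+-comm (zeroCount w′) (zeroPositionSum w′) ⟩
    zeroPositionSum w′ + zeroCount w′
      ≡⟨ sym (zeroPositionSum-∷ 1F w′) ⟩
    zeroPositionSum (1F Vec.∷ w′) ∎

letter : (x : Fin 2) → x ≡ 0F ⊎ x ≡ 1F
letter 0F = inj₁ refl
letter 1F = inj₂ refl

length-filter-allFin² : ∀ {n r} {R : Fin n × Fin n → Set r} (R? : ∀ pq → Dec (R pq)) →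
  length (filter R? (concatMap (λ p → map (λ q → (p , q)) (allFin n)) (allFin n)))
  ≡ ∑[ p < n ] ∑[ q < n ] 𝟙 (R? (p , q))
length-filter-allFin² {n} R? = begin
  length (filter R? pairs)
    ≡⟨ length-filter≡sum-𝟙 R? pairs ⟩
  sum (map (𝟙 ∘ R?) pairs)
    ≡⟨ sum-concatMap (𝟙 ∘ R?) (λ p → map (λ q → (p , q)) (allFin n)) (allFin n) ⟩
  sum (map (λ p → sum (map (𝟙 ∘ R?) (map (λ q → (p , q)) (allFin n)))) (allFin n))
    ≡⟨ sum-map-cong (allFin n) (λ {p} _ → row p) ⟩
  sum (map (λ p → ∑[ q < n ] 𝟙 (R? (p , q))) (allFin n))
    ≡⟨ sum-map-allFin (λ p → ∑[ q < n ] 𝟙 (R? (p , q))) ⟩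
  ∑[ p < n ] ∑[ q < n ] 𝟙 (R? (p , q)) ∎
  where
  open ≡-Reasoning
  pairs : List (Fin n × Fin n)
  pairs = concatMap (λ p → map (λ q → (p , q)) (allFin n)) (allFin n)
  row : ∀ p → sum (map (𝟙 ∘ R?) (map (λ q → (p , q)) (allFin n))) ≡ ∑[ q < n ] 𝟙 (R? (p , q))
  row p = trans (cong sum (sym (Listₚ.map-∘ (allFin n)))) (sum-map-allFin (λ q → 𝟙 (R? (p , q))))

module Ranks {n : ℕ} (d : ℕ) (w : Word n) where

  rank-0F : ∀ {x} → w x ≡ 0F → rank d w x ≡ occUpTo w 0F x ∸ 1
  rank-0F {x} eq with w x
  rank-0F refl | 0F = refl

  rank-1F : ∀ {x} → w x ≡ 1F → rank d w x ≡ d + (occUpTo w 1F x ∸ 1)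
  rank-1F {x} eq with w x
  rank-1F refl | 1F = refl

  occUpTo-positive : ∀ {x s} → w x ≡ s → 0 < occUpTo w s x
  occUpTo-positive {x} {s} eq = Listₚ.filter-some (λ q → (q ≤? x) ×-dec (w q ≟ s))
    (Any.map (λ { refl → ℕₚ.≤-refl , eq }) (∈-allFin x))

  occUpTo≤occ : ∀ x s → occUpTo w s x ≤ occ w s
  occUpTo≤occ x s = length-filter-mono (λ q → (q ≤? x) ×-dec (w q ≟ s)) (λ q → w q ≟ s) proj₂ (allFin n)

  occUpTo-strictMono : ∀ {p q s} → p Fin.< q → w q ≡ s → occUpTo w s p < occUpTo w s q
  occUpTo-strictMono {p} {q} {s} p<q eq = length-filter-strictMono
    (λ y → (y ≤? p) ×-dec (w y ≟ s)) (λ y → (y ≤? q) ×-dec (w y ≟ s))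
    (λ (y≤p , eq′) → ℕₚ.≤-trans y≤p (ℕₚ.<⇒≤ p<q) , eq′)
    (allFin n) (∈-allFin q) (ℕₚ.≤-refl , eq) (ℕₚ.<⇒≱ p<q ∘ proj₁)

  module _ (zeros≡d : occ w 0F ≡ d) where

    rank<d : ∀ {x} → w x ≡ 0F → rank d w x < d
    rank<d {x} eq with occUpTo w 0F x | occUpTo-positive eq | occUpTo≤occ x 0F | rank-0F eq
    ... | suc u | _ | u<occ | r≡u = subst (_< d) (sym r≡u) (subst (u <_) zeros≡d u<occ)

    d≤rank : ∀ {x} → w x ≡ 1F → d ≤ rank d w x
    d≤rank eq = subst (d ≤_) (sym (rank-1F eq)) (ℕₚ.m≤m+n d _)

    inverted⇒10 : ∀ {p q} → p Fin.< q × rank d w q < rank d w p → w p ≡ 1F × (p Fin.< q × w q ≡ 0F)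
    inverted⇒10 {p} {q} (p<q , rq<rp) with letter (w p) | letter (w q)
    ... | inj₂ wp≡1 | inj₁ wq≡0 = wp≡1 , p<q , wq≡0
    ... | inj₁ wp≡0 | inj₁ wq≡0 = contradiction
      (subst₂ _<_ (rank-0F wq≡0) (rank-0F wp≡0) rq<rp)
      (ℕₚ.≤⇒≯ (ℕₚ.∸-monoˡ-≤ 1 (ℕₚ.<⇒≤ (occUpTo-strictMono p<q wq≡0))))
    ... | inj₂ wp≡1 | inj₂ wq≡1 = contradiction
      (subst₂ _<_ (rank-1F wq≡1) (rank-1F wp≡1) rq<rp)
      (ℕₚ.≤⇒≯ (ℕₚ.+-monoʳ-≤ d (ℕₚ.∸-monoˡ-≤ 1 (ℕₚ.<⇒≤ (occUpTo-strictMono p<q wq≡1)))))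
    ... | inj₁ wp≡0 | inj₂ wq≡1 = contradiction rq<rp (ℕₚ.<⇒≯ (ℕₚ.<-≤-trans (rank<d wp≡0) (d≤rank wq≡1)))

    10⇒inverted : ∀ {p q} → w p ≡ 1F × (p Fin.< q × w q ≡ 0F) → p Fin.< q × rank d w q < rank d w p
    10⇒inverted (wp≡1 , p<q , wq≡0) = p<q , ℕₚ.<-≤-trans (rank<d wq≡0) (d≤rank wp≡1)

-- The ranks place all 0s before all 1s and keep equal letters in order, so the inverted pairs
-- are exactly the pairs of a 1 followed by a 0.
inversions≡onesBeforeZeros : ∀ {n d} (w : Word n) → occ w 0F ≡ d → inversions d w ≡ onesBeforeZeros w
inversions≡onesBeforeZeros {n} {d} w zeros≡d = begin
  inversions d w
    ≡⟨ length-filter-allFin² inverted? ⟩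
  ∑[ p < n ] ∑[ q < n ] 𝟙 (inverted? (p , q))
    ≡⟨ sum-cong-≗ {n} (λ p → sum-cong-≗ {n} (λ q → 𝟙-⇔ (inverted⇒10 zeros≡d) (10⇒inverted zeros≡d)
         (inverted? (p , q)) ((w p ≟ 1F) ×-dec ((p <? q) ×-dec (w q ≟ 0F))))) ⟩
  ∑[ p < n ] ∑[ q < n ] 𝟙 ((w p ≟ 1F) ×-dec ((p <? q) ×-dec (w q ≟ 0F)))
    ≡⟨ sum-cong-≗ {n} (λ p → sum-cong-≗ {n} (λ q → factor p q)) ⟩
  ∑[ p < n ] ∑[ q < n ] (𝟙 (w p ≟ 1F) * (𝟙 (p <? q) * 𝟙 (w q ≟ 0F)))
    ≡⟨ sum-cong-≗ {n} (λ p → sym (*-distribˡ-sum {n} (𝟙 (w p ≟ 1F)) (λ q → 𝟙 (p <? q) * 𝟙 (w q ≟ 0F)))) ⟩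
  onesBeforeZeros w ∎
  where
  open ≡-Reasoning
  open Ranks d w
  inverted? : ∀ pq → Dec (proj₁ pq Fin.< proj₂ pq × rank d w (proj₂ pq) < rank d w (proj₁ pq))
  inverted? (p , q) = (p <? q) ×-dec (rank d w q ℕ.<? rank d w p)
  factor : ∀ p q → 𝟙 ((w p ≟ 1F) ×-dec ((p <? q) ×-dec (w q ≟ 0F)))
                   ≡ 𝟙 (w p ≟ 1F) * (𝟙 (p <? q) * 𝟙 (w q ≟ 0F))
  factor p q = trans (𝟙-×-dec (w p ≟ 1F) ((p <? q) ×-dec (w q ≟ 0F)))
                     (cong (𝟙 (w p ≟ 1F) *_) (𝟙-×-dec (p <? q) (w q ≟ 0F)))

_≟ᵂ_ : ∀ {n} (ℓ w : Word n) → ∀ p → Dec (ℓ p ≡ w p)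
(ℓ ≟ᵂ w) p = ℓ p ≟ w p

𝟙-all?-∷ : ∀ {n} s (ℓ : Word n) (w : Word (suc n)) →
           𝟙 (all? ((s Vec.∷ ℓ) ≟ᵂ w)) ≡ 𝟙 (s ≟ w 0F) * 𝟙 (all? (ℓ ≟ᵂ Vec.tail w))
𝟙-all?-∷ s ℓ w = trans (𝟙-⇔ to from (all? ((s Vec.∷ ℓ) ≟ᵂ w)) ((s ≟ w 0F) ×-dec all? (ℓ ≟ᵂ Vec.tail w)))
                       (𝟙-×-dec (s ≟ w 0F) (all? (ℓ ≟ᵂ Vec.tail w)))
  where
  to : (s Vec.∷ ℓ) ≗ w → s ≡ w 0F × ℓ ≗ Vec.tail w
  to eq = eq 0F , eq ∘ Fin.suc
  from : s ≡ w 0F × ℓ ≗ Vec.tail w → (s Vec.∷ ℓ) ≗ w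
  from (eq₀ , _)  0F          = eq₀
  from (_ , eqₛ) (Fin.suc p) = eqₛ p

count-≗ : ∀ {n} (w : Word n) → sum (map (λ ℓ → 𝟙 (all? (ℓ ≟ᵂ w))) (allWords n)) ≡ 1
count-≗ {zero}  w = refl
count-≗ {suc n} w = begin
  sum (map (λ ℓ → 𝟙 (all? (ℓ ≟ᵂ w))) (allWords (suc n)))
    ≡⟨ foldr-allWords-suc ℕₚ.+-0-monoid (λ ℓ → 𝟙 (all? (ℓ ≟ᵂ w))) (λ {ℓ} {ℓ′} ℓ≗ℓ′ → 𝟙-⇔
         (λ ℓ≗w p → trans (sym (ℓ≗ℓ′ p)) (ℓ≗w p)) (λ ℓ′≗w p → trans (ℓ≗ℓ′ p) (ℓ′≗w p))
         (all? (ℓ ≟ᵂ w)) (all? (ℓ′ ≟ᵂ w))) ⟩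
  sum (map (λ w′ → 𝟙 (all? ((0F Vec.∷ w′) ≟ᵂ w)) + 𝟙 (all? ((1F Vec.∷ w′) ≟ᵂ w))) (allWords n))
    ≡⟨ sum-map-cong (allWords n) (λ {w′} _ →
         trans (cong₂ _+_ (𝟙-all?-∷ 0F w′ w) (𝟙-all?-∷ 1F w′ w)) (one-letter (w 0F) (𝟙 (all? (w′ ≟ᵂ Vec.tail w))))) ⟩
  sum (map (λ w′ → 𝟙 (all? (w′ ≟ᵂ Vec.tail w))) (allWords n))
    ≡⟨ count-≗ (Vec.tail w) ⟩
  1 ∎
  where
  open ≡-Reasoning
  one-letter : ∀ t x → 𝟙 (0F ≟ t) * x + 𝟙 (1F ≟ t) * x ≡ x
  one-letter 0F x = trans (ℕₚ.+-identityʳ (1 * x)) (ℕₚ.*-identityˡ x)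
  one-letter 1F x = ℕₚ.*-identityˡ x

exactly-one : ∀ (s : Fin 2) {x y} → x ≢ y → 𝟙 (x ≟ s) + 𝟙 (y ≟ s) ≡ 1
exactly-one _  {0F} {0F} x≢y = contradiction refl x≢y
exactly-one _  {1F} {1F} x≢y = contradiction refl x≢y
exactly-one 0F {0F} {1F} _   = refl
exactly-one 1F {0F} {1F} _   = refl
exactly-one 0F {1F} {0F} _   = refl
exactly-one 1F {1F} {0F} _   = refl

sum-map-const-1 : ∀ {a} {A : Set a} (xs : List A) → sum (map (λ _ → 1) xs) ≡ length xs
sum-map-const-1 []       = refl
sum-map-const-1 (x ∷ xs) = cong suc (sum-map-const-1 xs)

module Labelings {n : ℕ} (M : PerfectMatching n) where
  open Matching M

  occ-consistent : ∀ {w} → ConsistentLabeling M w → ∀ s → occ w s ≡ length arcs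
  occ-consistent {w} consistent s = begin
    occ w s
      ≡⟨ length-filter≡sum-𝟙 (λ p → w p ≟ s) (allFin n) ⟩
    sum (map (λ p → 𝟙 (w p ≟ s)) (allFin n))
      ≡⟨ sum-allFin≡sum-arcs (λ p → 𝟙 (w p ≟ s)) ⟩
    sum (map (λ a → 𝟙 (w a ≟ s) + 𝟙 (w (μ M a) ≟ s)) arcs)
      ≡⟨ sum-map-cong arcs (λ {a} _ → exactly-one s (consistent a)) ⟩
    sum (map (λ _ → 1) arcs)
      ≡⟨ sum-map-const-1 arcs ⟩
    length arcs ∎
    where open ≡-Reasoning

  labelsWord? : ∀ (w ℓ : Word n) → Dec (ConsistentLabeling M ℓ × (∀ p → boundaryWord ℓ p ≡ w p))
  labelsWord? w ℓ = consistent? M ℓ ×-dec all? (ℓ ≟ᵂ w)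

  aW-consistent : ∀ {w} → ConsistentLabeling M w → aW M w ≡ 1
  aW-consistent {w} consistent =
    trans (length-filter≡sum-𝟙 (labelsWord? w) (allWords n))
    (trans (sum-map-cong (allWords n) (λ {ℓ} _ →
              𝟙-⇔ proj₂ (λ ℓ≗w → (λ a → subst₂ _≢_ (sym (ℓ≗w a)) (sym (ℓ≗w (μ M a))) (consistent a)) , ℓ≗w)
                  (labelsWord? w ℓ) (all? (ℓ ≟ᵂ w))))
           (count-≗ w))

  aW-inconsistent : ∀ {w} → ¬ ConsistentLabeling M w → aW M w ≡ 0
  aW-inconsistent {w} inconsistent =
    cong length (Listₚ.filter-none (labelsWord? w)
      (All.universal (λ ℓ (consistent , ℓ≗w) → inconsistent λ a →
        subst₂ _≢_ (ℓ≗w a) (ℓ≗w (μ M a)) (consistent a)) (allWords n)))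

parity-arc : ∀ {x y : Fin 2} → x ≢ y → ∀ a b m → b ≡ suc (a + (m + m)) →
             parity (𝟙 (x ≟ 0F) * a + 𝟙 (y ≟ 0F) * b) ≡ parity (a + 𝟙 (x ≟ 1F))
parity-arc {0F} {0F} x≢y _ _ _ _ = contradiction refl x≢y
parity-arc {1F} {1F} x≢y _ _ _ _ = contradiction refl x≢y
parity-arc {0F} {1F} _   a b m _ = cong parity (ℕₚ.+-identityʳ (a + 0))
parity-arc {1F} {0F} _   a b m b≡ = begin
  parity (b + 0)                  ≡⟨ cong parity (trans (ℕₚ.+-identityʳ b) b≡) ⟩
  not (parity (a + (m + m)))      ≡⟨ cong not (trans (parity-+ a (m + m)) (cong (parity a xor_) (parity-double m))) ⟩
  not (parity a xor false)        ≡⟨ cong not (Boolₚ.xor-identityʳ (parity a)) ⟩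
  parity (1 + a)                  ≡⟨ cong parity (ℕₚ.+-comm 1 a) ⟩
  parity (a + 1)                  ∎
  where open ≡-Reasoning

module ArcParity {k : ℕ} (T : SYT2 k) (M : PerfectMatching (2 * k))
                 (NC : Noncrossing M) (AT : ArcsFromTableau T M) where
  open Matching M
  open NoncrossingMatching {M = M} NC
  open Tableau T
  open Labelings M

  onesOnLeftEnds : Word (2 * k) → ℕ
  onesOnLeftEnds w = sum (map (λ a → 𝟙 (w a ≟ 1F)) arcs)

  length-arcs≡k : length arcs ≡ k
  length-arcs≡k = ℕₚ.*-cancelˡ-≡ (length arcs) k 2
    (trans (cong (length arcs +_) (ℕₚ.+-identityʳ (length arcs))) length-arcs)

  zeroPositionSum-parity : ∀ {w} → ConsistentLabeling M w →
    parity (zeroPositionSum w) ≡ parity (sum (map toℕ arcs) + onesOnLeftEnds w)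
  zeroPositionSum-parity {w} consistent = begin
    parity (zeroPositionSum w)
      ≡⟨ cong parity (trans (sym (sum-map-allFin zeroAt)) (sum-allFin≡sum-arcs zeroAt)) ⟩
    parity (sum (map (λ a → zeroAt a + zeroAt (μ M a)) arcs))
      ≡⟨ parity-sum-map-cong arcs (λ {a} a∈ → let (m , μa≡) = arc-length-odd a (∈-arcs⁻ a∈) in
                                              parity-arc (consistent a) (toℕ a) (toℕ (μ M a)) m μa≡) ⟩
    parity (sum (map (λ a → toℕ a + 𝟙 (w a ≟ 1F)) arcs))
      ≡⟨ cong parity (sum-map-+ toℕ (λ a → 𝟙 (w a ≟ 1F)) arcs) ⟩
    parity (sum (map toℕ arcs) + onesOnLeftEnds w) ∎
    where
    open ≡-Reasoning
    zeroAt : Fin (2 * k) → ℕ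
    zeroAt q = 𝟙 (w q ≟ 0F) * toℕ q

  inversions-parity : ∀ {w} → ConsistentLabeling M w →
    parity (inversions k w) ≡ parity (firstColumnExcess + onesOnLeftEnds w)
  inversions-parity {w} consistent =
    parity-+-cancelʳ (inversions k w) (firstColumnExcess + onesOnLeftEnds w) (triangular k) (begin
    parity (inversions k w + triangular k)
      ≡⟨ cong (λ i → parity (i + triangular k)) (inversions≡onesBeforeZeros w zeros≡k) ⟩
    parity (onesBeforeZeros w + triangular k)
      ≡⟨ cong (λ z → parity (onesBeforeZeros w + triangular z)) (sym (trans (sym (occ≡∑ w 0F)) zeros≡k)) ⟩
    parity (onesBeforeZeros w + triangular (zeroCount w))
      ≡⟨ cong parity (onesBeforeZeros+triangular w) ⟩
    parity (zeroPositionSum w)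
      ≡⟨ zeroPositionSum-parity consistent ⟩
    parity (sum (map toℕ arcs) + onesOnLeftEnds w)
      ≡⟨ cong (λ s → parity (s + onesOnLeftEnds w)) (sum-arcs M AT) ⟩
    parity (firstColumnExcess + triangular k + onesOnLeftEnds w)
      ≡⟨ cong parity (+-rightComm firstColumnExcess (triangular k) (onesOnLeftEnds w)) ⟩
    parity (firstColumnExcess + onesOnLeftEnds w + triangular k) ∎)
    where
    open ≡-Reasoning
    zeros≡k : occ w 0F ≡ k
    zeros≡k = trans (occ-consistent consistent 0F) length-arcs≡k

infixl 6 _[_]≔_
_[_]≔_ : ∀ {n} → Word n → Fin n → Fin 2 → Word n
w [ p ]≔ s = Vec.updateAt w p (const s)

≔-cong : ∀ {n} {w w′ : Word n} → w ≗ w′ → ∀ p s → (w [ p ]≔ s) ≗ (w′ [ p ]≔ s)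
≔-cong w≗w′ 0F          s 0F          = refl
≔-cong w≗w′ 0F          s (Fin.suc q) = w≗w′ (Fin.suc q)
≔-cong w≗w′ (Fin.suc p) s 0F          = w≗w′ 0F
≔-cong w≗w′ (Fin.suc p) s (Fin.suc q) = ≔-cong (w≗w′ ∘ Fin.suc) p s q

module RingSums {c ℓ} (R : CommutativeRing c ℓ) where
  open CommutativeRing R
    renaming (_+_ to _⊕_; _*_ to _·_; refl to ≈-refl; sym to ≈-sym; trans to ≈-trans; reflexive to ≈-reflexive)
  open import Algebra.Properties.Ring ring using (-1*x≈-x; -‿distribˡ-*; -‿involutive)
  open import Algebra.Properties.CommutativeSemigroup *-commutativeSemigroup using (x∙yz≈y∙xz)
  open import Algebra.Properties.CommutativeSemigroup +-commutativeSemigroup using (interchange)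
  open import Relation.Binary.Reasoning.Setoid setoid
  open import Data.List.Relation.Binary.Permutation.Setoid.Properties setoid using (foldr-commMonoid)

  prodList-↭ : ∀ {xs ys} → xs ↭ ys → prodList R xs ≈ prodList R ys
  prodList-↭ = foldr-commMonoid *-isCommutativeMonoid ∘ ↭⇒↭ₛ′ isEquivalence

  module _ {a} {A : Set a} where

    prodList-map-cong : ∀ {f g : A → Carrier} xs → (∀ {x} → x ∈ xs → f x ≈ g x) →
                        prodList R (map f xs) ≈ prodList R (map g xs)
    prodList-map-cong []       _   = ≈-refl
    prodList-map-cong (x ∷ xs) f≈g = *-cong (f≈g (here refl)) (prodList-map-cong xs (f≈g ∘ there))

    sumList-map-cong : ∀ {f g : A → Carrier} xs → (∀ x → f x ≈ g x) →
                       sumList R (map f xs) ≈ sumList R (map g xs)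
    sumList-map-cong []       _   = ≈-refl
    sumList-map-cong (x ∷ xs) f≈g = +-cong (f≈g x) (sumList-map-cong xs f≈g)

    prodList-map-* : ∀ (f g : A → Carrier) xs →
                     prodList R (map (λ x → f x · g x) xs) ≈ prodList R (map f xs) · prodList R (map g xs)
    prodList-map-* f g []       = ≈-sym (*-identityʳ 1#)
    prodList-map-* f g (x ∷ xs) = begin
      (f x · g x) · prodList R (map (λ x → f x · g x) xs)     ≈⟨ *-congˡ (prodList-map-* f g xs) ⟩
      (f x · g x) · (prodList R (map f xs) · prodList R (map g xs)) ≈⟨ *-assoc (f x) (g x) _ ⟩
      f x · (g x · (prodList R (map f xs) · prodList R (map g xs))) ≈⟨ *-congˡ (x∙yz≈y∙xz (g x) _ _) ⟩
      f x · (prodList R (map f xs) · (g x · prodList R (map g xs))) ≈⟨ ≈-sym (*-assoc (f x) _ _) ⟩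
      (f x · prodList R (map f xs)) · (g x · prodList R (map g xs)) ∎

    prodList-map-zero : ∀ (f : A → Carrier) {y} xs → y ∈ xs → f y ≈ 0# → prodList R (map f xs) ≈ 0#
    prodList-map-zero f (x ∷ xs) (here refl) fy≈0 = ≈-trans (*-congʳ fy≈0) (zeroˡ _)
    prodList-map-zero f (x ∷ xs) (there y∈)  fy≈0 = ≈-trans (*-congˡ (prodList-map-zero f xs y∈ fy≈0)) (zeroʳ _)

    sumList-map-*ˡ : ∀ x (f : A → Carrier) xs → sumList R (map (λ y → x · f y) xs) ≈ x · sumList R (map f xs)
    sumList-map-*ˡ x f []       = ≈-sym (zeroʳ x)
    sumList-map-*ˡ x f (y ∷ ys) = ≈-trans (+-congˡ (sumList-map-*ˡ x f ys)) (≈-sym (distribˡ x _ _))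

    sumList-map-+ : ∀ (f g : A → Carrier) xs →
                    sumList R (map (λ x → f x ⊕ g x) xs) ≈ sumList R (map f xs) ⊕ sumList R (map g xs)
    sumList-map-+ f g []       = ≈-sym (+-identityʳ 0#)
    sumList-map-+ f g (x ∷ xs) =
      ≈-trans (+-congˡ (sumList-map-+ f g xs)) (interchange (f x) (g x) _ _)

  boolSign : Bool → Carrier
  boolSign false = 1#
  boolSign true  = - 1#

  signPow≈boolSign : ∀ m → signPow R m ≈ boolSign (parity m)
  signPow≈boolSign zero    = ≈-refl
  signPow≈boolSign (suc m) with parity m | signPow≈boolSign m
  ... | false | eq = -‿cong eq
  ... | true  | eq = ≈-trans (-‿cong eq) (-‿involutive 1#)

  signPow-parity : ∀ m n → parity m ≡ parity n → signPow R m ≈ signPow R n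
  signPow-parity m n eq =
    ≈-trans (signPow≈boolSign m) (≈-trans (≈-reflexive (cong boolSign eq)) (≈-sym (signPow≈boolSign n)))

  signPow-+ : ∀ m n → signPow R (m + n) ≈ signPow R m · signPow R n
  signPow-+ zero    n = ≈-sym (*-identityˡ _)
  signPow-+ (suc m) n = ≈-trans (-‿cong (signPow-+ m n)) (-‿distribˡ-* (signPow R m) (signPow R n))

  prodList-signPow : ∀ {a} {A : Set a} (f : A → ℕ) xs →
                     prodList R (map (signPow R ∘ f) xs) ≈ signPow R (sum (map f xs))
  prodList-signPow f []       = ≈-refl
  prodList-signPow f (x ∷ xs) = ≈-trans (*-congˡ (prodList-signPow f xs)) (≈-sym (signPow-+ (f x) _))

  Respects≗ : ∀ {n} → (Word n → Carrier) → Set _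
  Respects≗ G = ∀ {w w′} → w ≗ w′ → G w ≈ G w′

  sumOver : ∀ {n} → List (Fin n) → (Word n → Carrier) → Word n → Carrier
  sumOver []      G w = G w
  sumOver (p ∷ P) G w = sumOver P G (w [ p ]≔ 0F) ⊕ sumOver P G (w [ p ]≔ 1F)

  sumOver-respects : ∀ {n} (P : List (Fin n)) {G} → Respects≗ G → Respects≗ (sumOver P G)
  sumOver-respects []      G-resp w≗w′ = G-resp w≗w′
  sumOver-respects (p ∷ P) G-resp w≗w′ =
    +-cong (sumOver-respects P G-resp (≔-cong w≗w′ p 0F)) (sumOver-respects P G-resp (≔-cong w≗w′ p 1F))

  sumOver-cong : ∀ {n} (P : List (Fin n)) {G H} → (∀ w → G w ≈ H w) → ∀ w → sumOver P G w ≈ sumOver P H w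
  sumOver-cong []      G≈H w = G≈H w
  sumOver-cong (p ∷ P) G≈H w = +-cong (sumOver-cong P G≈H _) (sumOver-cong P G≈H _)

  sumOver-↭ : ∀ {n} {G : Word n → Carrier} → Respects≗ G → ∀ {P Q} → P ↭ Q → ∀ w → sumOver P G w ≈ sumOver Q G w
  sumOver-↭ G-resp ↭.refl        w = ≈-refl
  sumOver-↭ G-resp (↭.prep p P↭Q) w = +-cong (sumOver-↭ G-resp P↭Q _) (sumOver-↭ G-resp P↭Q _)
  sumOver-↭ G-resp (↭.trans P↭Q Q↭S) w = ≈-trans (sumOver-↭ G-resp P↭Q w) (sumOver-↭ G-resp Q↭S w)
  sumOver-↭ {G = G} G-resp {x ∷ y ∷ P} {.y ∷ .x ∷ Q} (↭.swap .x .y P↭Q) w with x ≟ y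
  ... | yes refl = +-cong (+-cong (term 0F 0F) (term 0F 1F)) (+-cong (term 1F 0F) (term 1F 1F))
    where
    term : ∀ s t → sumOver P G (w [ x ]≔ s [ x ]≔ t) ≈ sumOver Q G (w [ x ]≔ s [ x ]≔ t)
    term s t = sumOver-↭ G-resp P↭Q _
  ... | no x≢y = ≈-trans (+-cong (+-cong (term 0F 0F) (term 0F 1F)) (+-cong (term 1F 0F) (term 1F 1F)))
                         (interchange _ _ _ _)
    where
    term : ∀ s t → sumOver P G (w [ x ]≔ s [ y ]≔ t) ≈ sumOver Q G (w [ y ]≔ t [ x ]≔ s)
    term s t = ≈-trans (sumOver-↭ G-resp P↭Q _)
                       (sumOver-respects Q G-resp (Vecₚ.updateAt-commutes y x (x≢y ∘ sym) w))

  sumOver-map-suc : ∀ {n} (P : List (Fin n)) (G : Word (suc n) → Carrier) → Respects≗ G → ∀ w →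
    sumOver (map Fin.suc P) G w ≈ sumOver P (λ w′ → G (w 0F Vec.∷ w′)) (Vec.tail w)
  sumOver-map-suc []      G G-resp w = G-resp λ { 0F → refl ; (Fin.suc q) → refl }
  sumOver-map-suc (p ∷ P) G G-resp w =
    +-cong (sumOver-map-suc P G G-resp (w [ Fin.suc p ]≔ 0F)) (sumOver-map-suc P G G-resp (w [ Fin.suc p ]≔ 1F))

  sumList-allWords : ∀ {n} (G : Word n → Carrier) → Respects≗ G → ∀ w →
                     sumList R (map G (allWords n)) ≈ sumOver (allFin n) G w
  sumList-allWords {zero}  G G-resp w = ≈-trans (+-identityʳ _) (G-resp λ ())
  sumList-allWords {suc n} G G-resp w = begin
    sumList R (map G (allWords (suc n)))
      ≈⟨ foldr-allWords-suc +-monoid G G-resp ⟩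
    sumList R (map (λ w′ → G (0F Vec.∷ w′) ⊕ G (1F Vec.∷ w′)) (allWords n))
      ≈⟨ sumList-map-+ (λ w′ → G (0F Vec.∷ w′)) (λ w′ → G (1F Vec.∷ w′)) (allWords n) ⟩
    sumList R (map (λ w′ → G (0F Vec.∷ w′)) (allWords n)) ⊕ sumList R (map (λ w′ → G (1F Vec.∷ w′)) (allWords n))
      ≈⟨ +-cong (sumList-allWords _ (G-resp ∘ ∷-cong 0F) (Vec.tail w))
                (sumList-allWords _ (G-resp ∘ ∷-cong 1F) (Vec.tail w)) ⟩
    sumOver (allFin n) (λ w′ → G (0F Vec.∷ w′)) (Vec.tail w) ⊕ sumOver (allFin n) (λ w′ → G (1F Vec.∷ w′)) (Vec.tail w)
      ≈⟨ ≈-sym (+-cong (first-letter 0F) (first-letter 1F)) ⟩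
    sumOver (allFin (suc n)) G w ∎
    where
    ∷-cong : ∀ s {w w′ : Word n} → w ≗ w′ → (s Vec.∷ w) ≗ (s Vec.∷ w′)
    ∷-cong s w≗w′ 0F          = refl
    ∷-cong s w≗w′ (Fin.suc q) = w≗w′ q
    first-letter : ∀ s → sumOver (tabulate Fin.suc) G (w [ 0F ]≔ s)
                         ≈ sumOver (allFin n) (λ w′ → G (s Vec.∷ w′)) (Vec.tail w)
    first-letter s = ≈-trans
      (≈-reflexive (cong (λ P → sumOver P G (w [ 0F ]≔ s)) (sym (Listₚ.map-tabulate id Fin.suc))))
                             (sumOver-map-suc (allFin n) G G-resp (w [ 0F ]≔ s))

  sumOver-factorˡ : ∀ {n} (P : List (Fin n)) a b (f : Fin 2 → Fin 2 → Carrier) G w → a ∉ P → b ∉ P →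
                    sumOver P (λ w′ → f (w′ a) (w′ b) · G w′) w ≈ f (w a) (w b) · sumOver P G w
  sumOver-factorˡ []      a b f G w _   _   = ≈-refl
  sumOver-factorˡ (p ∷ P) a b f G w a∉P b∉P =
    ≈-trans (+-cong (factor-at 0F) (factor-at 1F)) (≈-sym (distribˡ _ _ _))
    where
    factor-at : ∀ s → sumOver P (λ w′ → f (w′ a) (w′ b) · G w′) (w [ p ]≔ s)
                      ≈ f (w a) (w b) · sumOver P G (w [ p ]≔ s)
    factor-at s = ≈-trans (sumOver-factorˡ P a b f G (w [ p ]≔ s) (a∉P ∘ there) (b∉P ∘ there))
      (*-congʳ (≈-reflexive (cong₂ f (Vecₚ.updateAt-minimal a p w (a∉P ∘ here))
                                     (Vecₚ.updateAt-minimal b p w (b∉P ∘ here)))))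

  sum₂ : (Fin 2 → Fin 2 → Carrier) → Carrier
  sum₂ f = (f 0F 0F ⊕ f 0F 1F) ⊕ (f 1F 0F ⊕ f 1F 1F)

  module _ {n} (M : PerfectMatching n) (φ : Fin n → Fin 2 → Fin 2 → Carrier) where
    open Matching M

    arcProduct : List (Fin n) → Word n → Carrier
    arcProduct as w = prodList R (map (λ a → φ a (w a) (w (μ M a))) as)

    arcProduct-respects : ∀ as → Respects≗ (arcProduct as)
    arcProduct-respects as w≗w′ = prodList-map-cong as (λ {a} _ → ≈-reflexive (cong₂ (φ a) (w≗w′ a) (w≗w′ (μ M a))))

    -- Each arc's two letters are summed independently, since distinct arcs occupy disjoint positions.
    sumOver-endpoints : ∀ as → Unique (endpoints as) → ∀ w →
                        sumOver (endpoints as) (arcProduct as) w ≈ prodList R (map (λ a → sum₂ (φ a)) as)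
    sumOver-endpoints []       _                         w = ≈-refl
    sumOver-endpoints (a ∷ as) (a∉ ∷ μa∉ ∷ endpoints-as!) w =
      ≈-trans (+-cong (+-cong (term 0F 0F) (term 0F 1F)) (+-cong (term 1F 0F) (term 1F 1F)))
              (≈-sym (≈-trans (distribʳ rest _ _) (+-cong (distribʳ rest _ _) (distribʳ rest _ _))))
      where
      rest : Carrier
      rest = prodList R (map (λ a → sum₂ (φ a)) as)
      term : ∀ s t → sumOver (endpoints as) (arcProduct (a ∷ as)) (w [ a ]≔ s [ μ M a ]≔ t) ≈ φ a s t · rest
      term s t = ≈-trans
        (sumOver-factorˡ (endpoints as) a (μ M a) (φ a) (arcProduct as) _
          (λ a∈ → All.lookup (All.tail a∉) a∈ refl) (λ μa∈ → All.lookup μa∉ μa∈ refl))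
        (*-cong (≈-reflexive (cong₂ (φ a)
                  (trans (Vecₚ.updateAt-minimal a (μ M a) (w [ a ]≔ s) (All.head a∉)) (Vecₚ.updateAt-updates a w))
                  (Vecₚ.updateAt-updates (μ M a) (w [ a ]≔ s))))
                (sumOver-endpoints as endpoints-as! _))

  ϵ : Fin 2 → Fin 2 → Carrier
  ϵ 0F 1F = 1#
  ϵ 1F 0F = - 1#
  ϵ _  _  = 0#

  ϵ-diag : ∀ {x y} → x ≡ y → ϵ x y ≈ 0#
  ϵ-diag {0F} refl = ≈-refl
  ϵ-diag {1F} refl = ≈-refl

  ϵ≈signPow : ∀ {x y} → x ≢ y → ϵ x y ≈ signPow R (𝟙 (x ≟ 1F))
  ϵ≈signPow {0F} {0F} x≢y = contradiction refl x≢y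
  ϵ≈signPow {0F} {1F} _   = ≈-refl
  ϵ≈signPow {1F} {0F} _   = ≈-refl
  ϵ≈signPow {1F} {1F} x≢y = contradiction refl x≢y

  sum₂-ϵ≈det2 : ∀ (x y : Fin 2 → Carrier) → sum₂ (λ i j → ϵ i j · (x i · y j)) ≈ det2 R x y
  sum₂-ϵ≈det2 x y = +-cong
    (≈-trans (+-congʳ (zeroˡ _)) (≈-trans (+-identityˡ _) (*-identityˡ _)))
    (≈-trans (+-congˡ (zeroˡ _)) (≈-trans (+-identityʳ _) (-1*x≈-x _)))

module WebInvariant {c ℓ} (R : CommutativeRing c ℓ) {k : ℕ} (T : SYT2 k) (M : PerfectMatching (2 * k))
                    (NC : Noncrossing M) (AT : ArcsFromTableau T M) where
  open CommutativeRing R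
    renaming (_+_ to _⊕_; _*_ to _·_; refl to ≈-refl; sym to ≈-sym; trans to ≈-trans; reflexive to ≈-reflexive)
  open RingSums R
  open Matching M
  open Labelings M
  open Tableau T
  open ArcParity T M NC AT

  arcSign : Word (2 * k) → Carrier
  arcSign w = prodList R (map (λ a → ϵ (w a) (w (μ M a))) arcs)

  arcSign-consistent : ∀ {w} → ConsistentLabeling M w → arcSign w ≈ signPow R (onesOnLeftEnds w)
  arcSign-consistent {w} consistent = ≈-trans
    (prodList-map-cong arcs (λ {a} _ → ϵ≈signPow (consistent a)))
    (prodList-signPow (λ a → 𝟙 (w a ≟ 1F)) arcs)

  arcSign-inconsistent : ∀ {w} → ¬ ConsistentLabeling M w → arcSign w ≈ 0#
  arcSign-inconsistent {w} inconsistent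
    with a , ¬w≢ ← Finₚ.¬∀⟶∃¬ (2 * k) _ (λ a → ¬? (w a ≟ w (μ M a))) inconsistent
    with decidable-stable (w a ≟ w (μ M a)) ¬w≢ | a <? μ M a
  ... | same | yes a<μa = prodList-map-zero (λ b → ϵ (w b) (w (μ M b))) arcs (∈-arcs⁺ a<μa) (ϵ-diag same)
  ... | same | no  a≮μa = prodList-map-zero (λ b → ϵ (w b) (w (μ M b))) arcs (∈-arcs⁺ (μ-<-flip a a≮μa))
                            (ϵ-diag (trans (sym same) (cong w (sym (invol M a)))))

  occ-consistent≡k : ∀ {w} → ConsistentLabeling M w → ∀ s → occ w s ≡ k
  occ-consistent≡k consistent s = trans (occ-consistent consistent s) length-arcs≡k

  webOnBasis-consistent : ∀ {w} → ConsistentLabeling M w → webOnBasis R k M w ≈ signPow R (inversions k w)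
  webOnBasis-consistent {w} consistent with balanced? k w
  ... | yes _ = ≈-trans (*-congˡ (≈-reflexive (cong (fromℕ R) (aW-consistent consistent))))
                        (≈-trans (*-congˡ (+-identityʳ 1#)) (*-identityʳ _))
  ... | no unbalanced =
    contradiction (occ-consistent≡k consistent 0F , occ-consistent≡k consistent 1F) unbalanced

  webOnBasis-inconsistent : ∀ {w} → ¬ ConsistentLabeling M w → webOnBasis R k M w ≈ 0#
  webOnBasis-inconsistent {w} inconsistent with balanced? k w
  ... | yes _ = ≈-trans (*-congˡ (≈-reflexive (cong (fromℕ R) (aW-inconsistent inconsistent)))) (zeroʳ _)
  ... | no  _ = ≈-refl

  webOnBasis≈ : ∀ w → webOnBasis R k M w ≈ tableauSign R T · arcSign w
  webOnBasis≈ w with consistent? M w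
  ... | yes consistent = begin
    webOnBasis R k M w
      ≈⟨ webOnBasis-consistent consistent ⟩
    signPow R (inversions k w)
      ≈⟨ signPow-parity (inversions k w) (firstColumnExcess + onesOnLeftEnds w) (inversions-parity consistent) ⟩
    signPow R (firstColumnExcess + onesOnLeftEnds w)
      ≈⟨ signPow-+ firstColumnExcess (onesOnLeftEnds w) ⟩
    signPow R firstColumnExcess · signPow R (onesOnLeftEnds w)
      ≈⟨ *-cong (≈-sym (prodList-signPow _ (allFin k))) (≈-sym (arcSign-consistent consistent)) ⟩
    tableauSign R T · arcSign w ∎
    where open import Relation.Binary.Reasoning.Setoid setoid
  ... | no inconsistent = ≈-trans (webOnBasis-inconsistent inconsistent)
    (≈-sym (≈-trans (*-congˡ (arcSign-inconsistent inconsistent)) (zeroʳ _)))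

  module _ (v : Fin (2 * k) → Fin 2 → Carrier) where

    φ : Fin (2 * k) → Fin 2 → Fin 2 → Carrier
    φ a x y = ϵ x y · (v a x · v (μ M a) y)

    monomial≈arcMonomial : ∀ (w : Word (2 * k)) →
      prodList R (map (λ p → v p (w p)) (allFin (2 * k)))
        ≈ prodList R (map (λ a → v a (w a) · v (μ M a) (w (μ M a))) arcs)
    monomial≈arcMonomial w = ≈-trans (prodList-↭ (↭ₚ.map⁺ (λ p → v p (w p)) allFin↭endpoints-arcs))
                                     (foldr-map-endpoints *-monoid (λ p → v p (w p)) arcs)

    webTerm≈ : ∀ (w : Word (2 * k)) →
      webOnBasis R k M w · prodList R (map (λ p → v p (w p)) (allFin (2 * k)))
        ≈ tableauSign R T · arcProduct M φ arcs w
    webTerm≈ w = ≈-trans (*-cong (webOnBasis≈ w) (monomial≈arcMonomial w))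
      (≈-trans (*-assoc (tableauSign R T) (arcSign w) _)
               (*-congˡ (≈-sym (prodList-map-* (λ a → ϵ (w a) (w (μ M a)))
                                               (λ a → v a (w a) · v (μ M a) (w (μ M a))) arcs))))

mainTheorem6 : ∀ {c ℓ : Level} (R : CommutativeRing c ℓ) (k : ℕ)
                 (T : SYT2 k) (M : PerfectMatching (2 * k)) →
                 Noncrossing M → ArcsFromTableau T M →
                 ∀ (v : Fin (2 * k) → Fin 2 → CommutativeRing.Carrier R) →
                 CommutativeRing._≈_ R (webInvariant R k M v)
                   (CommutativeRing._*_ R (tableauSign R T) (DeltaM R M v))
mainTheorem6 R k T M NC AT v = begin
  webInvariant R k M v
    ≈⟨ sumList-map-cong (allWords (2 * k)) (webTerm≈ v) ⟩
  sumList R (map (λ w → ε · arcProduct M (φ v) arcs w) (allWords (2 * k)))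
    ≈⟨ sumList-map-*ˡ ε (arcProduct M (φ v) arcs) (allWords (2 * k)) ⟩
  ε · sumList R (map (arcProduct M (φ v) arcs) (allWords (2 * k)))
    ≈⟨ *-congˡ (sumList-allWords (arcProduct M (φ v) arcs) (arcProduct-respects M (φ v) arcs) w₀) ⟩
  ε · sumOver (allFin (2 * k)) (arcProduct M (φ v) arcs) w₀
    ≈⟨ *-congˡ (sumOver-↭ (arcProduct-respects M (φ v) arcs) allFin↭endpoints-arcs w₀) ⟩
  ε · sumOver (endpoints arcs) (arcProduct M (φ v) arcs) w₀
    ≈⟨ *-congˡ (sumOver-endpoints M (φ v) arcs (endpoints-unique arcs arcs-unique (arcsIn-< (allFin (2 * k)))) w₀) ⟩
  ε · prodList R (map (λ a → sum₂ (φ v a)) arcs)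
    ≈⟨ *-congˡ (prodList-map-cong arcs (λ {a} _ → sum₂-ϵ≈det2 (v a) (v (μ M a)))) ⟩
  ε · DeltaM R M v ∎
  where
  open CommutativeRing R using (Carrier; _≈_; *-congˡ; setoid) renaming (_*_ to _·_)
  open import Relation.Binary.Reasoning.Setoid setoid
  open RingSums R
  open Matching M
  open WebInvariant R T M NC AT
  ε : Carrier
  ε = tableauSign R T
  -- sumOver over all positions does not depend on its base word.
  w₀ : Word (2 * k)
  w₀ _ = 0F
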